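{- Let $n$ be a multiple of $16$ and $\pi$ any permutation of $[n]$, and let $\mathcal{D}^{\mathsf{no}}_\pi$ and $f^{\mathsf{no}}_\pi$ be as defined in the context. Then for every linear threshold function $g:\{0,1\}^n\to\{0,1\}$, $$\Pr_{x\sim\mathcal{D}^{\mathsf{no}}_\pi}\big[g(x)\neq f^{\mathsf{no}}_\pi(x)\big]\ge\frac14.$$
   Context: $e_i\in\{0,1\}^n$ is the string with a single $1$ in coordinate $i$, and $\vee$ is bitwise OR. Let $K=\{n/8,n/8+1,\dots,n/4-1\}$. $\mathcal{D}^{\mathsf{no}}_\pi$ is the uniform distribution over the set $\bigcup_{k\in K}\{e_{\pi(4k+1)}\vee e_{\pi(4k+2)},\ e_{\pi(4k+2)}\vee e_{\pi(4k+3)},\ e_{\pi(4k+3)}\vee e_{\pi(4k+4)},\ e_{\pi(4k+4)}\vee e_{\pi(4k+1)}\}$. Define $\nu\in\{0,1\}^{n+1}$ by $\nu_{4k+1}=\nu_{4k+3}=0$, $\nu_{4k+2}=\nu_{4k+4}=1$ for $k\in K$, and $\nu_i=1$ for $i\in\{1,\dots,n/4-1\}\cup\{n+1\}$ (the remaining coordinates of $\nu$ play no role in the claim). For $x\in\{0,1\}^n$, let $i$ be the smallest element of $\pi^{ -1}(\mathrm{supp}(x))$ (where $\mathrm{supp}(x)=\{j:x_j=1\}$). If $i=4k+1$ for some $k\in K$ and $\pi^{ -1}(\mathrm{supp}(x))\cap\{4k+1,\dots,4k+4\}=\{4k+1,4k+4\}$, set $f^{\mathsf{no}}_\pi(x)=1$;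 otherwise set $f^{\mathsf{no}}_\pi(x)=\nu_j$ where $j$ is the smallest index with $x_{\pi(j)}=1$ (and $\nu_{n+1}$ if $x=0^n$). A linear threshold function is $g(x)=\mathbb{1}[w\cdot x\ge\theta]$ for some $w\in\mathbb{R}^n$, $\theta\in\mathbb{R}$. -}

module Defs where

open import Level using (Level; _⊔_) renaming (suc to lsuc)
open import Data.Bool using (Bool; true; false; _∧_; _∨_; not; if_then_else_)
open import Data.Nat using (ℕ; zero; suc)
open import Data.Fin using (Fin; toℕ; fromℕ; fromℕ<)
open import Data.Fin.Permutation using (Permutation′; _⟨$⟩ʳ_; _⟨$⟩ˡ_)
open import Data.List using (List; []; _∷_; map; upTo; concatMap; findᵇ; filter; length)
open import Data.Maybe using (Maybe; just; nothing)
open import Data.Product using (Σ)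
open import Algebra.Bundles using (CommutativeRing)
open import Relation.Binary.Structures using (IsDecTotalOrder)
open import Relation.Nullary using (¬_; does)
open import Relation.Nullary.Decidable using (⌊_⌋)

-- Ordered fields (the weights/threshold of an LTF live in ℝ, which is
-- not available; we quantify over every (decidably) totally ordered field,
-- of which ℝ is one).

record OrderedField (c ℓ₁ ℓ₂ : Level) : Set (lsuc (c ⊔ ℓ₁ ⊔ ℓ₂)) where
  field
    commRing : CommutativeRing c ℓ₁
  open CommutativeRing commRing public
  field
    _≤_ : Carrier → Carrier → Set ℓ₂
    isDecTotalOrder : IsDecTotalOrder _≈_ _≤_
    +-monoˡ-≤ : ∀ {x y} z → x ≤ y → (x + z) ≤ (y + z)
    *-nonneg : ∀ {x y} → 0# ≤ x → 0# ≤ y → 0# ≤ (x * y)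
    0≉1 : ¬ (0# ≈ 1#)
    inverse : ∀ x → ¬ (x ≈ 0#) → Σ Carrier (λ y → (x * y) ≈ 1#)
  open IsDecTotalOrder isDecTotalOrder public using (_≤?_)

module _ {c ℓ₁ ℓ₂ : Level} (F : OrderedField c ℓ₁ ℓ₂) where
  open OrderedField F

  bit : Bool → Carrier
  bit true  = 1#
  bit false = 0#

  dot : ∀ {n} → (Fin n → Carrier) → (Fin n → Bool) → Carrier
  dot {zero}  w x = 0#
  dot {suc n} w x = (w Fin.zero * bit (x Fin.zero)) + dot (λ i → w (Fin.suc i)) (λ i → x (Fin.suc i))
    where import Data.Fin as Fin

  ltf : ∀ {n} → (Fin n → Carrier) → Carrier → (Fin n → Bool) → Bool
  ltf w θ x = ⌊ θ ≤? dot w x ⌋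

-- Convention: the paper's 1-based position p ∈ {1,…,n} corresponds to the
-- 0-based index p-1; π(p) (paper) is  π ⟨$⟩ʳ (p-1)  here.  Positions below are
-- 0-based naturals; the paper's block {4k+1,…,4k+4} is {4k,…,4k+3}.

module _ {n : ℕ} (π : Permutation′ n) where
  open import Data.Nat using (_+_; _*_; _∸_; _≡ᵇ_; _<ᵇ_; _≤ᵇ_; _<?_)
  open import Data.Nat.DivMod using (_/_; _%_)

  xπ : (Fin n → Bool) → ℕ → Bool
  xπ x m with m <? n
  ... | Relation.Nullary.yes p = x (π ⟨$⟩ʳ fromℕ< p)
  ... | Relation.Nullary.no _  = false

  firstPos : (Fin n → Bool) → Maybe ℕ
  firstPos x = findᵇ (xπ x) (upTo n)

  inK : ℕ → Bool
  inK k = ((n / 8) ≤ᵇ k) ∧ (k <ᵇ (n / 4))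

  special : (Fin n → Bool) → ℕ → Bool
  special x m = ((m % 4) ≡ᵇ 0) ∧ inK (m / 4)
                ∧ xπ x m ∧ not (xπ x (m + 1)) ∧ not (xπ x (m + 2)) ∧ xπ x (m + 3)

  νat : (Fin (suc n) → Bool) → ℕ → Bool
  νat ν m with m <? suc n
  ... | Relation.Nullary.yes p = ν (fromℕ< p)
  ... | Relation.Nullary.no _  = false

  fno : (Fin (suc n) → Bool) → (Fin n → Bool) → Bool
  fno ν x with firstPos x
  ... | nothing = ν (fromℕ n)
  ... | just m  = if special x m then true else νat ν m

  pairStr : ℕ → ℕ → (Fin n → Bool)
  pairStr p q i = (toℕ (π ⟨$⟩ˡ i) ≡ᵇ p) ∨ (toℕ (π ⟨$⟩ˡ i) ≡ᵇ q)

  -- the elements of supp(D^no_π), listed (they are pairwise distinct)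
  blockStrs : ℕ → List (Fin n → Bool)
  blockStrs k = pairStr (4 * k) (4 * k + 1) ∷ pairStr (4 * k + 1) (4 * k + 2)
              ∷ pairStr (4 * k + 2) (4 * k + 3) ∷ pairStr (4 * k + 3) (4 * k) ∷ []

  Kset : List ℕ
  Kset = map (n / 8 +_) (upTo (n / 4 ∸ n / 8))

  suppDno : List (Fin n → Bool)
  suppDno = concatMap blockStrs Kset

  errors : (Fin (suc n) → Bool) → ((Fin n → Bool) → Bool) → ℕ
  errors ν g = length (filter (λ x → ¬? (g x ≟ fno ν x)) suppDno)
    where open import Data.Bool.Properties using (_≟_)
          open import Relation.Nullary.Decidable using (¬?)

  νSpec : (Fin (suc n) → Bool) → Set
  νSpec ν = (∀ k → T (inK k) →
                 (νat ν (4 * k) ≡ false) × (νat ν (4 * k + 2) ≡ false)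
               × (νat ν (4 * k + 1) ≡ true) × (νat ν (4 * k + 3) ≡ true))
          × (∀ i → T (suc i <ᵇ (n / 4)) → νat ν i ≡ true)
          × (ν (fromℕ n) ≡ true)
    where
      open import Data.Bool using (T)
      open import Data.Product using (_×_)
      open import Relation.Binary.PropositionalEquality using (_≡_)

module Submission where

-- Read through π, the four points of a
-- block are the edges {4k,4k+1}, {4k+1,4k+2}, {4k+2,4k+3}, {4k+3,4k} of a 4-cycle, so the
-- first and third sum to the same 0/1 vector as the second and fourth, and the same holds
-- for their inner products with any w.  By the choice of ν, f^no is 0, 1, 0, 1 on them (the
-- special rule fires only on the last edge); but a threshold function that accepts the
-- second and fourth and rejects the third must accept the first.  So each block of four
-- points carries an error.

open import Defs
open import Level using (Level)
open import Data.Nat using (ℕ; suc; _*_; _≤_)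
open import Data.Nat.Divisibility using (_∣_)
open import Data.Fin using (Fin)
open import Data.Bool using (Bool)
import Data.List
open import Data.Fin.Permutation using (Permutation′)

open import Data.Nat using (zero; _+_; _<_; _∸_; _⊓_; _≡ᵇ_; _<?_; s≤s; z≤n; z<s; >-nonZero)
open import Data.Nat.Properties
  using (_≟_; ≤-refl; <-trans; ≤-<-trans; +-assoc; +-comm; +-mono-≤; +-monoˡ-≤; +-monoʳ-≤; +-monoʳ-<; m≤m+n; m<m+n; n<1+n; n≤1+n;
         *-comm; *-suc; *-distribˡ-+; *-monoʳ-≤; m≤m*n; <⇒≢; m+[n∸m]≡n;
         ⊓-sel; m⊓n≤m; m<n⊓o⇒m<n; m<n⊓o⇒m<o; m≤n⇒m⊓n≡m; m≥n⇒m⊓n≡n; ≤⇒≤ᵇ; <⇒<ᵇ; <ᵇ⇒<; module ≤-Reasoning)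
open import Data.Nat.DivMod using (_/_; _%_; m*n%n≡0; m*n/n≡m; m/n*n≤m; /-monoʳ-≤)
open import Data.Fin using (toℕ)
open import Data.Fin.Properties using (toℕ-fromℕ<)
open import Data.Fin.Permutation using (_⟨$⟩ˡ_; inverseˡ)
open import Data.Bool using (true; false; _∧_; _∨_; not; if_then_else_; T)
open import Data.Bool.Properties using (∨-zeroʳ; ∧-zeroʳ; T-∧; T-≡) renaming (_≟_ to _≟ᵇ_)
open import Data.List using (List; []; _∷_; _++_; length; filter; applyUpTo; findᵇ; concatMap)
open import Data.List.Properties using (length-++; filter-++; filter-some)
open import Data.List.Relation.Unary.Any using (Any)
open import Data.List.Relation.Unary.All as All using (All; []; _∷_)
open import Data.List.Relation.Unary.All.Properties using (map⁺; applyUpTo⁺₁; ¬All⇒Any¬)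
open import Data.Maybe using (just)
open import Data.Product using (_×_; _,_; proj₁; proj₂)
open import Data.Sum using (inj₁; inj₂)
open import Data.Empty using (⊥)
open import Function using (id; _∘_)
open import Function.Bundles using (Equivalence)
open import Relation.Nullary using (¬_; yes; no; contradiction)
open import Relation.Nullary.Decidable using (¬?; toWitness; toWitnessFalse; dec-true; dec-false)
open import Relation.Unary using (Pred; Decidable)
open import Relation.Binary.Bundles using (Poset)
open import Relation.Binary.Structures using (IsDecTotalOrder)
open import Relation.Binary.PropositionalEquality using (_≡_; _≢_; refl; sym; trans; cong; cong₂; subst; module ≡-Reasoning)

module _ {c ℓ₁ ℓ₂ : Level} (F : OrderedField c ℓ₁ ℓ₂) where
  open OrderedField F
    using (Carrier; _≈_; -_; setoid; -‿inverseʳ; distribˡ; isDecTotalOrder)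
    renaming (_+_ to _⊕_; _*_ to _⊗_; _≤_ to _≼_; _≤?_ to _≼?_;
              +-comm to ⊕-comm; +-assoc to ⊕-assoc; +-cong to ⊕-cong; +-identityʳ to ⊕-identityʳ;
              *-cong to ⊗-cong; +-monoˡ-≤ to ⊕-monoˡ-≼; refl to ≈-refl; sym to ≈-sym; trans to ≈-trans)
  open import Algebra.Properties.CommutativeSemigroup (OrderedField.+-commutativeSemigroup F)
    using (interchange)

  open IsDecTotalOrder isDecTotalOrder using (isPartialOrder; total)

  private
    poset : Poset c ℓ₁ ℓ₂
    poset = record { isPartialOrder = isPartialOrder }

  ⊕-monoʳ-≼ : ∀ {x y} z → x ≼ y → (z ⊕ x) ≼ (z ⊕ y)
  ⊕-monoʳ-≼ {x} {y} z x≼y = begin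
    z ⊕ x  ≈⟨ ⊕-comm z x ⟩
    x ⊕ z  ≤⟨ ⊕-monoˡ-≼ z x≼y ⟩
    y ⊕ z  ≈⟨ ⊕-comm y z ⟩
    z ⊕ y  ∎
    where open import Relation.Binary.Reasoning.PartialOrder poset

  ⊕-cancelʳ-≼ : ∀ {x y} z → (x ⊕ z) ≼ (y ⊕ z) → x ≼ y
  ⊕-cancelʳ-≼ {x} {y} z le = begin
    x                ≈⟨ ≈-sym (add-neg-cancel x) ⟩
    (x ⊕ z) ⊕ (- z)  ≤⟨ ⊕-monoˡ-≼ (- z) le ⟩
    (y ⊕ z) ⊕ (- z)  ≈⟨ add-neg-cancel y ⟩
    y                ∎
    where
      open import Relation.Binary.Reasoning.PartialOrder poset
      add-neg-cancel : ∀ t → ((t ⊕ z) ⊕ (- z)) ≈ t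
      add-neg-cancel t = ≈-trans (⊕-assoc t z (- z)) (≈-trans (⊕-cong ≈-refl (-‿inverseʳ z)) (⊕-identityʳ t))

  balanced-sum-≼ : ∀ {a b c d θ} → (a ⊕ c) ≈ (b ⊕ d) → θ ≼ b → θ ≼ d → c ≼ θ → θ ≼ a
  balanced-sum-≼ {a} {b} {c} {d} {θ} eq θ≼b θ≼d c≼θ = ⊕-cancelʳ-≼ θ (begin
    θ ⊕ θ  ≤⟨ ⊕-monoˡ-≼ θ θ≼b ⟩
    b ⊕ θ  ≤⟨ ⊕-monoʳ-≼ b θ≼d ⟩
    b ⊕ d  ≈⟨ ≈-sym eq ⟩
    a ⊕ c  ≤⟨ ⊕-monoʳ-≼ a c≼θ ⟩
    a ⊕ θ  ∎)
    where open import Relation.Binary.Reasoning.PartialOrder poset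

  dot-balanced : ∀ {n} (w : Fin n → Carrier) (x₁ x₂ x₃ x₄ : Fin n → Bool) →
    (∀ i → (bit F (x₁ i) ⊕ bit F (x₃ i)) ≈ (bit F (x₂ i) ⊕ bit F (x₄ i))) →
    (dot F w x₁ ⊕ dot F w x₃) ≈ (dot F w x₂ ⊕ dot F w x₄)
  dot-balanced {zero}  w x₁ x₂ x₃ x₄ bits = ≈-refl
  dot-balanced {suc n} w x₁ x₂ x₃ x₄ bits = begin
      (w₀ ⊗ b x₁ ⊕ r x₁) ⊕ (w₀ ⊗ b x₃ ⊕ r x₃)
    ≈⟨ interchange _ _ _ _ ⟩
      (w₀ ⊗ b x₁ ⊕ w₀ ⊗ b x₃) ⊕ (r x₁ ⊕ r x₃)
    ≈⟨ ⊕-cong (≈-sym (distribˡ w₀ (b x₁) (b x₃))) (dot-balanced (w ∘ Fin.suc) _ _ _ _ (bits ∘ Fin.suc)) ⟩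
      w₀ ⊗ (b x₁ ⊕ b x₃) ⊕ (r x₂ ⊕ r x₄)
    ≈⟨ ⊕-cong (⊗-cong ≈-refl (bits Fin.zero)) ≈-refl ⟩
      w₀ ⊗ (b x₂ ⊕ b x₄) ⊕ (r x₂ ⊕ r x₄)
    ≈⟨ ⊕-cong (distribˡ w₀ (b x₂) (b x₄)) ≈-refl ⟩
      (w₀ ⊗ b x₂ ⊕ w₀ ⊗ b x₄) ⊕ (r x₂ ⊕ r x₄)
    ≈⟨ interchange _ _ _ _ ⟩
      (w₀ ⊗ b x₂ ⊕ r x₂) ⊕ (w₀ ⊗ b x₄ ⊕ r x₄)
    ∎
    where
      import Data.Fin as Fin
      open import Relation.Binary.Reasoning.Setoid setoid
      w₀ : Carrier
      w₀ = w Fin.zero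
      b : (Fin (suc n) → Bool) → Carrier
      b x = bit F (x Fin.zero)
      r : (Fin (suc n) → Bool) → Carrier
      r x = dot F (w ∘ Fin.suc) (x ∘ Fin.suc)

  ltf-no-alternation : ∀ {n} (w : Fin n → Carrier) θ (x₁ x₂ x₃ x₄ : Fin n → Bool) →
    (∀ i → (bit F (x₁ i) ⊕ bit F (x₃ i)) ≈ (bit F (x₂ i) ⊕ bit F (x₄ i))) →
    ltf F w θ x₁ ≡ false → ltf F w θ x₂ ≡ true → ltf F w θ x₃ ≡ false → ltf F w θ x₄ ≡ true → ⊥
  ltf-no-alternation w θ x₁ x₂ x₃ x₄ bits g₁ g₂ g₃ g₄ =
    below x₁ g₁ (balanced-sum-≼ (dot-balanced w x₁ x₂ x₃ x₄ bits) (above x₂ g₂) (above x₄ g₄) x₃≼θ)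
    where
      above : ∀ x → ltf F w θ x ≡ true → θ ≼ dot F w x
      above x g = toWitness {a? = θ ≼? dot F w x} (subst T (sym g) _)
      below : ∀ x → ltf F w θ x ≡ false → ¬ (θ ≼ dot F w x)
      below x g = toWitnessFalse {a? = θ ≼? dot F w x} (subst (T ∘ not) (sym g) _)
      x₃≼θ : dot F w x₃ ≼ θ
      x₃≼θ with total θ (dot F w x₃)
      ... | inj₁ θ≼x₃ = contradiction θ≼x₃ (below x₃ g₃)
      ... | inj₂ x₃≼θ = x₃≼θ

  cycle-bits : ∀ j a →
    (bit F ((j ≡ᵇ a) ∨ (j ≡ᵇ a + 1)) ⊕ bit F ((j ≡ᵇ a + 2) ∨ (j ≡ᵇ a + 3)))
      ≈ (bit F ((j ≡ᵇ a + 1) ∨ (j ≡ᵇ a + 2)) ⊕ bit F ((j ≡ᵇ a + 3) ∨ (j ≡ᵇ a)))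
  cycle-bits zero    zero    = ⊕-comm _ _
  cycle-bits zero    (suc a) = ≈-refl
  cycle-bits (suc j) (suc a) = cycle-bits j a
  cycle-bits 1       zero    = ≈-refl
  cycle-bits 2       zero    = ⊕-comm _ _
  cycle-bits 3       zero    = ≈-refl
  cycle-bits (suc (suc (suc (suc j)))) zero = ≈-refl

findᵇ-applyUpTo : ∀ (p : ℕ → Bool) f n m → m < n → p (f m) ≡ true → (∀ j → j < m → p (f j) ≡ false) →
                  findᵇ p (applyUpTo f n) ≡ just (f m)
findᵇ-applyUpTo p f (suc n) zero    _         pm _     rewrite pm = refl
findᵇ-applyUpTo p f (suc n) (suc m) (s≤s m<n) pm below rewrite below 0 z<s =
  findᵇ-applyUpTo p (f ∘ suc) n m m<n pm (λ j j<m → below (suc j) (s≤s j<m))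

wrap-edge-pattern : ∀ a → let hit m = (m ≡ᵇ a + 3) ∨ (m ≡ᵇ a) in
  (hit a ∧ not (hit (a + 1)) ∧ not (hit (a + 2)) ∧ hit (a + 3)) ≡ true
wrap-edge-pattern zero    = refl
wrap-edge-pattern (suc a) = wrap-edge-pattern a

length-concatMap≤*length-filter : ∀ {A : Set} {P : Pred A Level.zero} (P? : Decidable P) (blocks : ℕ → List A) {m} →
  ∀ ks → All (λ k → length (blocks k) ≤ m × Any P (blocks k)) ks →
  length (concatMap blocks ks) ≤ m * length (filter P? (concatMap blocks ks))
length-concatMap≤*length-filter P? blocks         []       []                 = z≤n
length-concatMap≤*length-filter P? blocks {m} (k ∷ ks) ((len , hit) ∷ hyps) = begin
  length (xs ++ ys)                    ≡⟨ length-++ xs ⟩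
  length xs + length ys                ≤⟨ +-mono-≤ len (length-concatMap≤*length-filter P? blocks ks hyps) ⟩
  m + m * c ys                         ≤⟨ +-monoˡ-≤ (m * c ys) (m≤m*n m (c xs) {{>-nonZero (filter-some P? hit)}}) ⟩
  m * c xs + m * c ys                  ≡⟨ *-distribˡ-+ m (c xs) (c ys) ⟨
  m * (c xs + c ys)                    ≡⟨ cong (m *_) (length-++ (filter P? xs)) ⟨
  m * length (filter P? xs ++ filter P? ys) ≡⟨ cong (λ l → m * length l) (filter-++ P? xs ys) ⟨
  m * c (xs ++ ys)                     ∎
  where
    open ≤-Reasoning
    xs = blocks k
    ys = concatMap blocks ks
    c : List _ → ℕ
    c l = length (filter P? l)

module _ {n : ℕ} (π : Permutation′ n) where

  xπ-pairStr : ∀ {p q} → p < n → q < n → ∀ m → xπ π (pairStr π p q) m ≡ ((m ≡ᵇ p) ∨ (m ≡ᵇ q))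
  xπ-pairStr {p} {q} p<n q<n m with m <? n
  ... | yes m<n = trans (cong (λ i → (toℕ i ≡ᵇ p) ∨ (toℕ i ≡ᵇ q)) (inverseˡ π))
                        (cong (λ j → (j ≡ᵇ p) ∨ (j ≡ᵇ q)) (toℕ-fromℕ< m<n))
  ... | no m≮n = sym (cong₂ _∨_ (dec-false (m ≟ p) (outside p<n)) (dec-false (m ≟ q) (outside q<n)))
    where
      outside : ∀ {r} → r < n → m ≢ r
      outside r<n refl = m≮n r<n

  firstPos-pairStr : ∀ {p q} → p < n → q < n → firstPos π (pairStr π p q) ≡ just (p ⊓ q)
  firstPos-pairStr {p} {q} p<n q<n =
    findᵇ-applyUpTo (xπ π (pairStr π p q)) id n (p ⊓ q) (≤-<-trans (m⊓n≤m p q) p<n) first-hit before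
    where
      first-hit : xπ π (pairStr π p q) (p ⊓ q) ≡ true
      first-hit with ⊓-sel p q
      ... | inj₁ eq rewrite eq | xπ-pairStr p<n q<n p = cong (_∨ (p ≡ᵇ q)) (dec-true (p ≟ p) refl)
      ... | inj₂ eq rewrite eq | xπ-pairStr p<n q<n q =
        trans (cong ((q ≡ᵇ p) ∨_) (dec-true (q ≟ q) refl)) (∨-zeroʳ _)
      before : ∀ j → j < p ⊓ q → xπ π (pairStr π p q) j ≡ false
      before j j<p⊓q rewrite xπ-pairStr p<n q<n j =
        cong₂ _∨_ (dec-false (j ≟ p) (<⇒≢ (m<n⊓o⇒m<n p q j<p⊓q)))
                  (dec-false (j ≟ q) (<⇒≢ (m<n⊓o⇒m<o p q j<p⊓q)))

  fno-firstPos : ∀ ν x {m} → firstPos π x ≡ just m →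
                 fno π ν x ≡ (if special π x m then true else νat π ν m)
  fno-firstPos ν x eq rewrite eq = refl

  special-false : ∀ x m → xπ π x (m + 1) ≡ true → special π x m ≡ false
  special-false x m hit rewrite hit | ∧-zeroʳ (xπ π x m) | ∧-zeroʳ (inK π (m / 4)) = ∧-zeroʳ _

  fno-pairStr-adjacent : ∀ ν p q → q ≡ p + 1 → q < n → fno π ν (pairStr π p q) ≡ νat π ν p
  fno-pairStr-adjacent ν p .(p + 1) refl q<n = begin
    fno π ν x                                       ≡⟨ fno-firstPos ν x first ⟩
    (if special π x p then true else νat π ν p)     ≡⟨ cong (if_then true else νat π ν p) (special-false x p hit) ⟩
    νat π ν p                                       ∎
    where
      open ≡-Reasoning
      x = pairStr π p (p + 1)
      p<n : p < n
      p<n = <-trans (m<m+n p z<s) q<n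
      first : firstPos π x ≡ just p
      first = trans (firstPos-pairStr p<n q<n) (cong just (m≤n⇒m⊓n≡m (m≤m+n p 1)))
      hit : xπ π x (p + 1) ≡ true
      hit = trans (xπ-pairStr p<n q<n (p + 1))
                  (trans (cong ((p + 1 ≡ᵇ p) ∨_) (dec-true (p + 1 ≟ p + 1) refl)) (∨-zeroʳ _))

  inK⇒block< : ∀ {k} → T (inK π k) → 4 * k + 3 < n
  inK⇒block< {k} hk = begin-strict
    4 * k + 3    <⟨ +-monoʳ-< (4 * k) (n<1+n 3) ⟩
    4 * k + 4    ≡⟨ +-comm (4 * k) 4 ⟩
    4 + 4 * k    ≡⟨ *-suc 4 k ⟨
    4 * suc k    ≤⟨ *-monoʳ-≤ 4 (<ᵇ⇒< k (n / 4) (proj₂ (Equivalence.to T-∧ hk))) ⟩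
    4 * (n / 4)  ≡⟨ *-comm 4 (n / 4) ⟩
    n / 4 * 4    ≤⟨ m/n*n≤m n 4 ⟩
    n            ∎
    where open ≤-Reasoning

  fno-pairStr-wrap : ∀ ν {k} → T (inK π k) → fno π ν (pairStr π (4 * k + 3) (4 * k)) ≡ true
  fno-pairStr-wrap ν {k} hk =
    trans (fno-firstPos ν x first) (cong (if_then true else νat π ν a) special-fires)
    where
      a = 4 * k
      x = pairStr π (a + 3) a
      a+3<n : a + 3 < n
      a+3<n = inK⇒block< hk
      a<n : a < n
      a<n = ≤-<-trans (m≤m+n a 3) a+3<n
      first : firstPos π x ≡ just a
      first = trans (firstPos-pairStr a+3<n a<n) (cong just (m≥n⇒m⊓n≡n (m≤m+n a 3)))
      special-fires : special π x a ≡ true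
      special-fires
        rewrite xπ-pairStr a+3<n a<n a | xπ-pairStr a+3<n a<n (a + 1)
              | xπ-pairStr a+3<n a<n (a + 2) | xπ-pairStr a+3<n a<n (a + 3)
              | trans (cong (_% 4) (*-comm 4 k)) (m*n%n≡0 k 4)
              | trans (cong (_/ 4) (*-comm 4 k)) (m*n/n≡m k 4)
              | Equivalence.to T-≡ hk
        = wrap-edge-pattern a

  block-has-error : ∀ {c ℓ₁ ℓ₂} (F : OrderedField c ℓ₁ ℓ₂) w θ ν → νSpec π ν →
    ∀ {k} → T (inK π k) → Any (λ x → ¬ (ltf F w θ x ≡ fno π ν x)) (blockStrs π k)
  block-has-error F w θ ν νspec {k} hk =
    ¬All⇒Any¬ (λ x → ltf F w θ x ≟ᵇ fno π ν x) (blockStrs π k) fits-none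
    where
      a = 4 * k
      ν-block = proj₁ νspec k hk
      a+3<n : a + 3 < n
      a+3<n = inK⇒block< hk
      a+2<n : a + 2 < n
      a+2<n = ≤-<-trans (+-monoʳ-≤ a (n≤1+n 2)) a+3<n
      a+1<n : a + 1 < n
      a+1<n = ≤-<-trans (+-monoʳ-≤ a (n≤1+n 1)) a+2<n
      f₁ : fno π ν (pairStr π a (a + 1)) ≡ false
      f₁ = trans (fno-pairStr-adjacent ν a (a + 1) refl a+1<n) (proj₁ ν-block)
      f₂ : fno π ν (pairStr π (a + 1) (a + 2)) ≡ true
      f₂ = trans (fno-pairStr-adjacent ν (a + 1) (a + 2) (sym (+-assoc a 1 1)) a+2<n)
                 (proj₁ (proj₂ (proj₂ ν-block)))
      f₃ : fno π ν (pairStr π (a + 2) (a + 3)) ≡ false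
      f₃ = trans (fno-pairStr-adjacent ν (a + 2) (a + 3) (sym (+-assoc a 2 1)) a+3<n)
                 (proj₁ (proj₂ ν-block))
      fits-none : ¬ All (λ x → ltf F w θ x ≡ fno π ν x) (blockStrs π k)
      fits-none (e₁ ∷ e₂ ∷ e₃ ∷ e₄ ∷ []) =
        ltf-no-alternation F w θ _ _ _ _ (λ i → cycle-bits F (toℕ (π ⟨$⟩ˡ i)) a)
          (trans e₁ f₁) (trans e₂ f₂) (trans e₃ f₃) (trans e₄ (fno-pairStr-wrap ν hk))

  Kset-inK : All (T ∘ inK π) (Kset π)
  Kset-inK = map⁺ (applyUpTo⁺₁ id (n / 4 ∸ n / 8) offset-inK)
    where
      offset-inK : ∀ {i} → i < n / 4 ∸ n / 8 → T (inK π (n / 8 + i))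
      offset-inK {i} i<d = Equivalence.from T-∧ (≤⇒≤ᵇ (m≤m+n (n / 8) i) , <⇒<ᵇ (begin-strict
        n / 8 + i                <⟨ +-monoʳ-< (n / 8) i<d ⟩
        n / 8 + (n / 4 ∸ n / 8)  ≡⟨ m+[n∸m]≡n (/-monoʳ-≤ n (m≤m+n 4 4)) ⟩
        n / 4                    ∎))
        where open ≤-Reasoning

lemma7p1 : ∀ {c ℓ₁ ℓ₂ : Level} (F : OrderedField c ℓ₁ ℓ₂)
           (n : ℕ) → 16 ∣ n → (π : Permutation′ n)
           (ν : Fin (suc n) → Bool) → νSpec π ν →
           (w : Fin n → OrderedField.Carrier F) (θ : OrderedField.Carrier F) →
           Data.List.length (suppDno π) ≤ 4 * errors π ν (ltf F w θ)
lemma7p1 F n _ π ν νspec w θ =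
  length-concatMap≤*length-filter (λ x → ¬? (ltf F w θ x ≟ᵇ fno π ν x)) (blockStrs π) (Kset π)
    (All.map (λ hk → ≤-refl , block-has-error π F w θ ν νspec hk) (Kset-inK π))
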